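{- $\mathbf{ACT}_\omega$ is strongly complete with respect to algebraic models on infinitary action lattices ($\omega$ALs) that are complete as lattices (i.e., in which all suprema and infima of arbitrary subsets exist); likewise, $\mathbf{ACT}^+_\omega$ is strongly complete with respect to algebraic models on $*$-continuous positive action lattices ($\omega$PALs) that are complete as lattices.
   Context: An SRBL is $(K;\preceq,\cdot,\backslash,/,\wedge,\vee,\top,\bot)$ where $(K;\preceq,\wedge,\vee,\top,\bot)$ is a bounded lattice, $\cdot$ is associative, and $b\preceq a\backslash c\iff a\cdot b\preceq c\iff a\preceq c/b$. An $\omega$PAL is an SRBL with a unary $^+$ such that $a^+=\sup\{a^n\mid n\ge1\}$. An RBL is an SRBL with an element $\mathbf 1$ that is a unit for $\cdot$; an $\omega$AL is an RBL with $^*$ such that $a^*=\sup\{a^n\mid n\ge0\}$ ($a^0=\mathbf 1$). An algebraic model is an interpretation of variables in the algebra extended homomorphically to formulae (constants to designated elements); $A_1,\dots,A_n\to B$ is true if $\alpha(A_1)\cdots\alpha(A_n)\preceq\alpha(B)$, and $\to B$ is true if $\mathbf 1\preceq\alpha(B)$. Strong completeness: whenever $\Pi\to C$ is true in every such model where all of $\mathcal H$ are true, $\mathcal H\vdash\Pi\to C$. $\mathbf{ACT}_\omega$: formulae over variables, constants $\top,\bot,\mathbf 1$, operations $\backslash,/,\cdot,\wedge,\vee,{}^*$; sequents with $n\ge0$ antecedent formulae; rules: $A\to A$; $\Gamma,\bot,\Delta\to C$; $\Pi\to\top$; $\to\mathbf 1$; from $\Gamma,\Delta\to C$ infer $\Gamma,\mathbf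 1,\Delta\to C$; standard Lambek rules for $\cdot$ (left: $\Gamma,A,B,\Delta\to C\,/\,\Gamma,A\cdot B,\Delta\to C$; right: $\Gamma\to A,\Delta\to B\,/\,\Gamma,\Delta\to A\cdot B$), for $\backslash$ (from $\Pi\to A$, $\Gamma,B,\Delta\to C$ infer $\Gamma,\Pi,A\backslash B,\Delta\to C$; from $A,\Pi\to B$ infer $\Pi\to A\backslash B$), for $/$ symmetrically, lattice rules for $\wedge,\vee$, Cut, and for $^*$: from $\Gamma,A^n,\Delta\to C$ for all $n\ge0$ infer $\Gamma,A^*,\Delta\to C$; from $\Pi_i\to A$ ($i=1..n$, $n\ge0$) infer $\Pi_1,\dots,\Pi_n\to A^*$. $\mathbf{ACT}^+_\omega$: same without $\mathbf 1$, with $^+$ instead of $^*$ (rules with $n\ge1$), sequents required to have non-empty antecedents and the right rules for $\backslash,/$ require $\Pi$ non-empty. Derivations may be infinite but well-founded. -}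

module Defs where

open import Level using (Level; _⊔_; Setω) renaming (suc to lsuc)
open import Data.Nat using (ℕ; zero; suc)
open import Data.Product using (Σ; _×_; _,_)
open import Data.List using (List; []; _∷_; _++_; [_]; replicate; concat)
open import Data.List.NonEmpty using (List⁺; _∷_; toList)
open import Data.List.Membership.Propositional using (_∈_)
open import Relation.Binary.Lattice using (BoundedLattice)

record SRBL (c ℓ₁ ℓ₂ : Level) : Set (lsuc (c ⊔ ℓ₁ ⊔ ℓ₂)) where
  field
    boundedLattice : BoundedLattice c ℓ₁ ℓ₂
  open BoundedLattice boundedLattice public
  infixl 7 _·_
  field
    _·_ : Carrier → Carrier → Carrier
    _∖_ : Carrier → Carrier → Carrier
    _⁄_ : Carrier → Carrier → Carrier
    ·-assoc : ∀ a b d → ((a · b) · d) ≈ (a · (b · d))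
    resid-∖ : ∀ a b d → (b ≤ (a ∖ d) → (a · b) ≤ d) × ((a · b) ≤ d → b ≤ (a ∖ d))
    resid-⁄ : ∀ a b d → (a ≤ (d ⁄ b) → (a · b) ≤ d) × ((a · b) ≤ d → a ≤ (d ⁄ b))

record RBL (c ℓ₁ ℓ₂ : Level) : Set (lsuc (c ⊔ ℓ₁ ⊔ ℓ₂)) where
  field
    srbl : SRBL c ℓ₁ ℓ₂
  open SRBL srbl public
  field
    𝟙 : Carrier
    𝟙-unitˡ : ∀ a → (𝟙 · a) ≈ a
    𝟙-unitʳ : ∀ a → (a · 𝟙) ≈ a

module _ {c ℓ₁ ℓ₂} (L : BoundedLattice c ℓ₁ ℓ₂) where
  open BoundedLattice L
  IsLUB : ∀ {i} {I : Set i} → (I → Carrier) → Carrier → Set (i ⊔ c ⊔ ℓ₂)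
  IsLUB {I = I} f s = (∀ k → f k ≤ s) × (∀ z → (∀ k → f k ≤ z) → s ≤ z)
  IsGLB : ∀ {i} {I : Set i} → (I → Carrier) → Carrier → Set (i ⊔ c ⊔ ℓ₂)
  IsGLB {I = I} f s = (∀ k → s ≤ f k) × (∀ z → (∀ k → z ≤ f k) → z ≤ s)

  IsComplete : (ℓ : Level) → Set (lsuc ℓ ⊔ c ⊔ ℓ₂)
  IsComplete ℓ = (I : Set ℓ) (f : I → Carrier) →
                 Σ Carrier (IsLUB f) × Σ Carrier (IsGLB f)

-- positive powers a^(n+1) in a semigroup: pow⁺ a n = a^(n+1)
module _ {c ℓ₁ ℓ₂} (S : SRBL c ℓ₁ ℓ₂) where
  open SRBL S
  pow⁺ : Carrier → ℕ → Carrier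
  pow⁺ a zero = a
  pow⁺ a (suc n) = a · pow⁺ a n

module _ {c ℓ₁ ℓ₂} (R : RBL c ℓ₁ ℓ₂) where
  open RBL R
  pow : Carrier → ℕ → Carrier
  pow a zero = 𝟙
  pow a (suc n) = a · pow a n

record ωPAL (c ℓ₁ ℓ₂ : Level) : Set (lsuc (c ⊔ ℓ₁ ⊔ ℓ₂)) where
  field
    srbl : SRBL c ℓ₁ ℓ₂
  open SRBL srbl public
  field
    _⁺ : Carrier → Carrier
    ⁺-sup : ∀ a → IsLUB boundedLattice (pow⁺ srbl a) (a ⁺)

record ωAL (c ℓ₁ ℓ₂ : Level) : Set (lsuc (c ⊔ ℓ₁ ⊔ ℓ₂)) where
  field
    rbl : RBL c ℓ₁ ℓ₂
  open RBL rbl public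
  field
    _⋆ : Carrier → Carrier
    ⋆-sup : ∀ a → IsLUB boundedLattice (pow rbl a) (a ⋆)

record CompleteωAL (c ℓ₁ ℓ₂ ℓ : Level) : Set (lsuc (c ⊔ ℓ₁ ⊔ ℓ₂ ⊔ ℓ)) where
  field
    ωal : ωAL c ℓ₁ ℓ₂
    complete : IsComplete (ωAL.boundedLattice ωal) ℓ
  open ωAL ωal public

record CompleteωPAL (c ℓ₁ ℓ₂ ℓ : Level) : Set (lsuc (c ⊔ ℓ₁ ⊔ ℓ₂ ⊔ ℓ)) where
  field
    ωpal : ωPAL c ℓ₁ ℓ₂
    complete : IsComplete (ωPAL.boundedLattice ωpal) ℓ
  open ωPAL ωpal public

infixr 6 _∖ᶠ_
infixl 6 _⁄ᶠ_
infixl 7 _·ᶠ_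
infixl 5 _∧ᶠ_ _∨ᶠ_
infix 8 _⋆ᶠ
infix 2 _⊢_⇒_

data Fm : Set where
  var : ℕ → Fm
  ⊤ᶠ ⊥ᶠ 𝟏ᶠ : Fm
  _∖ᶠ_ _⁄ᶠ_ _·ᶠ_ _∧ᶠ_ _∨ᶠ_ : Fm → Fm → Fm
  _⋆ᶠ : Fm → Fm

Seq : Set
Seq = List Fm × Fm

data _⊢_⇒_ {h} (H : Seq → Set h) : List Fm → Fm → Set h where
  hyp  : ∀ {Π C} → H (Π , C) → H ⊢ Π ⇒ C
  ax   : ∀ {A} → H ⊢ [ A ] ⇒ A
  ⊥L   : ∀ {Γ Δ C} → H ⊢ Γ ++ ⊥ᶠ ∷ Δ ⇒ C
  ⊤R   : ∀ {Π} → H ⊢ Π ⇒ ⊤ᶠ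
  𝟏R   : H ⊢ [] ⇒ 𝟏ᶠ
  𝟏L   : ∀ {Γ Δ C} → H ⊢ Γ ++ Δ ⇒ C → H ⊢ Γ ++ 𝟏ᶠ ∷ Δ ⇒ C
  ·L   : ∀ {Γ Δ A B C} → H ⊢ Γ ++ A ∷ B ∷ Δ ⇒ C → H ⊢ Γ ++ (A ·ᶠ B) ∷ Δ ⇒ C
  ·R   : ∀ {Γ Δ A B} → H ⊢ Γ ⇒ A → H ⊢ Δ ⇒ B → H ⊢ Γ ++ Δ ⇒ A ·ᶠ B
  ∖L   : ∀ {Γ Π Δ A B C} → H ⊢ Π ⇒ A → H ⊢ Γ ++ B ∷ Δ ⇒ C →
         H ⊢ Γ ++ Π ++ (A ∖ᶠ B) ∷ Δ ⇒ C
  ∖R   : ∀ {Π A B} → H ⊢ A ∷ Π ⇒ B → H ⊢ Π ⇒ A ∖ᶠ B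
  ⁄L   : ∀ {Γ Π Δ A B C} → H ⊢ Π ⇒ A → H ⊢ Γ ++ B ∷ Δ ⇒ C →
         H ⊢ Γ ++ (B ⁄ᶠ A) ∷ Π ++ Δ ⇒ C
  ⁄R   : ∀ {Π A B} → H ⊢ Π ++ [ A ] ⇒ B → H ⊢ Π ⇒ B ⁄ᶠ A
  ∧L₁  : ∀ {Γ Δ A B C} → H ⊢ Γ ++ A ∷ Δ ⇒ C → H ⊢ Γ ++ (A ∧ᶠ B) ∷ Δ ⇒ C
  ∧L₂  : ∀ {Γ Δ A B C} → H ⊢ Γ ++ B ∷ Δ ⇒ C → H ⊢ Γ ++ (A ∧ᶠ B) ∷ Δ ⇒ C
  ∧R   : ∀ {Π A B} → H ⊢ Π ⇒ A → H ⊢ Π ⇒ B → H ⊢ Π ⇒ A ∧ᶠ B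
  ∨L   : ∀ {Γ Δ A B C} → H ⊢ Γ ++ A ∷ Δ ⇒ C → H ⊢ Γ ++ B ∷ Δ ⇒ C →
         H ⊢ Γ ++ (A ∨ᶠ B) ∷ Δ ⇒ C
  ∨R₁  : ∀ {Π A B} → H ⊢ Π ⇒ A → H ⊢ Π ⇒ A ∨ᶠ B
  ∨R₂  : ∀ {Π A B} → H ⊢ Π ⇒ B → H ⊢ Π ⇒ A ∨ᶠ B
  cut  : ∀ {Γ Π Δ A C} → H ⊢ Π ⇒ A → H ⊢ Γ ++ A ∷ Δ ⇒ C → H ⊢ Γ ++ Π ++ Δ ⇒ C
  ⋆L   : ∀ {Γ Δ A C} → (∀ n → H ⊢ Γ ++ replicate n A ++ Δ ⇒ C) →
         H ⊢ Γ ++ (A ⋆ᶠ) ∷ Δ ⇒ C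
  ⋆R   : ∀ {A} (Πs : List (List Fm)) → (∀ {Π} → Π ∈ Πs → H ⊢ Π ⇒ A) →
         H ⊢ concat Πs ⇒ A ⋆ᶠ

module _ {c ℓ₁ ℓ₂ ℓ} (M : CompleteωAL c ℓ₁ ℓ₂ ℓ) (α : ℕ → CompleteωAL.Carrier M) where
  open CompleteωAL M
  ⟦_⟧ : Fm → Carrier
  ⟦ var x ⟧ = α x
  ⟦ ⊤ᶠ ⟧ = ⊤
  ⟦ ⊥ᶠ ⟧ = ⊥
  ⟦ 𝟏ᶠ ⟧ = 𝟙
  ⟦ A ∖ᶠ B ⟧ = ⟦ A ⟧ ∖ ⟦ B ⟧
  ⟦ A ⁄ᶠ B ⟧ = ⟦ A ⟧ ⁄ ⟦ B ⟧
  ⟦ A ·ᶠ B ⟧ = ⟦ A ⟧ · ⟦ B ⟧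
  ⟦ A ∧ᶠ B ⟧ = ⟦ A ⟧ ∧ ⟦ B ⟧
  ⟦ A ∨ᶠ B ⟧ = ⟦ A ⟧ ∨ ⟦ B ⟧
  ⟦ A ⋆ᶠ ⟧ = ⟦ A ⟧ ⋆

  ⟦_⟧* : List Fm → Carrier
  ⟦ [] ⟧* = 𝟙
  ⟦ A ∷ [] ⟧* = ⟦ A ⟧
  ⟦ A ∷ B ∷ Π ⟧* = ⟦ A ⟧ · ⟦ B ∷ Π ⟧*

  TrueIn : Seq → Set ℓ₂
  TrueIn (Π , C) = ⟦ Π ⟧* ≤ ⟦ C ⟧

StrongCompletenessACTω : Setω
StrongCompletenessACTω =
  ∀ {h} (H : Seq → Set h) (Π : List Fm) (C : Fm) →
  (∀ {c ℓ₁ ℓ₂ ℓ} (M : CompleteωAL c ℓ₁ ℓ₂ ℓ) (α : ℕ → CompleteωAL.Carrier M) →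
     (∀ s → H s → TrueIn M α s) → TrueIn M α (Π , C)) →
  H ⊢ Π ⇒ C

infixr 6 _∖ᵖ_
infixl 6 _⁄ᵖ_
infixl 7 _·ᵖ_
infixl 5 _∧ᵖ_ _∨ᵖ_
infix 8 _⁺ᵖ
infix 2 _⊢⁺_⇒_

data Fm⁺ : Set where
  var : ℕ → Fm⁺
  ⊤ᵖ ⊥ᵖ : Fm⁺
  _∖ᵖ_ _⁄ᵖ_ _·ᵖ_ _∧ᵖ_ _∨ᵖ_ : Fm⁺ → Fm⁺ → Fm⁺
  _⁺ᵖ : Fm⁺ → Fm⁺

Seq⁺ : Set
Seq⁺ = List⁺ Fm⁺ × Fm⁺

data NonEmpty {A : Set} : List A → Set where
  nonEmpty : ∀ {x xs} → NonEmpty (x ∷ xs)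

-- The index is an ordinary list,
-- but every rule only produces sequents with non-empty antecedent
-- (hypotheses are non-empty by typing; ⊤R and the right rules for ∖, ⁄
-- demand Π non-empty; ⁺R demands n ≥ 1 premises).
data _⊢⁺_⇒_ {h} (H : Seq⁺ → Set h) : List Fm⁺ → Fm⁺ → Set h where
  hyp  : ∀ {Π C} → H (Π , C) → H ⊢⁺ toList Π ⇒ C
  ax   : ∀ {A} → H ⊢⁺ [ A ] ⇒ A
  ⊥L   : ∀ {Γ Δ C} → H ⊢⁺ Γ ++ ⊥ᵖ ∷ Δ ⇒ C
  ⊤R   : ∀ {Π} → NonEmpty Π → H ⊢⁺ Π ⇒ ⊤ᵖ
  ·L   : ∀ {Γ Δ A B C} → H ⊢⁺ Γ ++ A ∷ B ∷ Δ ⇒ C → H ⊢⁺ Γ ++ (A ·ᵖ B) ∷ Δ ⇒ C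
  ·R   : ∀ {Γ Δ A B} → H ⊢⁺ Γ ⇒ A → H ⊢⁺ Δ ⇒ B → H ⊢⁺ Γ ++ Δ ⇒ A ·ᵖ B
  ∖L   : ∀ {Γ Π Δ A B C} → H ⊢⁺ Π ⇒ A → H ⊢⁺ Γ ++ B ∷ Δ ⇒ C →
         H ⊢⁺ Γ ++ Π ++ (A ∖ᵖ B) ∷ Δ ⇒ C
  ∖R   : ∀ {Π A B} → NonEmpty Π → H ⊢⁺ A ∷ Π ⇒ B → H ⊢⁺ Π ⇒ A ∖ᵖ B
  ⁄L   : ∀ {Γ Π Δ A B C} → H ⊢⁺ Π ⇒ A → H ⊢⁺ Γ ++ B ∷ Δ ⇒ C →
         H ⊢⁺ Γ ++ (B ⁄ᵖ A) ∷ Π ++ Δ ⇒ C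
  ⁄R   : ∀ {Π A B} → NonEmpty Π → H ⊢⁺ Π ++ [ A ] ⇒ B → H ⊢⁺ Π ⇒ B ⁄ᵖ A
  ∧L₁  : ∀ {Γ Δ A B C} → H ⊢⁺ Γ ++ A ∷ Δ ⇒ C → H ⊢⁺ Γ ++ (A ∧ᵖ B) ∷ Δ ⇒ C
  ∧L₂  : ∀ {Γ Δ A B C} → H ⊢⁺ Γ ++ B ∷ Δ ⇒ C → H ⊢⁺ Γ ++ (A ∧ᵖ B) ∷ Δ ⇒ C
  ∧R   : ∀ {Π A B} → H ⊢⁺ Π ⇒ A → H ⊢⁺ Π ⇒ B → H ⊢⁺ Π ⇒ A ∧ᵖ B
  ∨L   : ∀ {Γ Δ A B C} → H ⊢⁺ Γ ++ A ∷ Δ ⇒ C → H ⊢⁺ Γ ++ B ∷ Δ ⇒ C →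
         H ⊢⁺ Γ ++ (A ∨ᵖ B) ∷ Δ ⇒ C
  ∨R₁  : ∀ {Π A B} → H ⊢⁺ Π ⇒ A → H ⊢⁺ Π ⇒ A ∨ᵖ B
  ∨R₂  : ∀ {Π A B} → H ⊢⁺ Π ⇒ B → H ⊢⁺ Π ⇒ A ∨ᵖ B
  cut  : ∀ {Γ Π Δ A C} → H ⊢⁺ Π ⇒ A → H ⊢⁺ Γ ++ A ∷ Δ ⇒ C → H ⊢⁺ Γ ++ Π ++ Δ ⇒ C
  ⁺L   : ∀ {Γ Δ A C} → (∀ n → H ⊢⁺ Γ ++ replicate (suc n) A ++ Δ ⇒ C) →
         H ⊢⁺ Γ ++ (A ⁺ᵖ) ∷ Δ ⇒ C
  ⁺R   : ∀ {A} (Π₁ : List Fm⁺) (Πs : List (List Fm⁺)) →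
         (∀ {Π} → Π ∈ Π₁ ∷ Πs → H ⊢⁺ Π ⇒ A) →
         H ⊢⁺ concat (Π₁ ∷ Πs) ⇒ A ⁺ᵖ

module _ {c ℓ₁ ℓ₂ ℓ} (M : CompleteωPAL c ℓ₁ ℓ₂ ℓ) (α : ℕ → CompleteωPAL.Carrier M) where
  open CompleteωPAL M
  ⟦_⟧⁺ : Fm⁺ → Carrier
  ⟦ var x ⟧⁺ = α x
  ⟦ ⊤ᵖ ⟧⁺ = ⊤
  ⟦ ⊥ᵖ ⟧⁺ = ⊥
  ⟦ A ∖ᵖ B ⟧⁺ = ⟦ A ⟧⁺ ∖ ⟦ B ⟧⁺
  ⟦ A ⁄ᵖ B ⟧⁺ = ⟦ A ⟧⁺ ⁄ ⟦ B ⟧⁺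
  ⟦ A ·ᵖ B ⟧⁺ = ⟦ A ⟧⁺ · ⟦ B ⟧⁺
  ⟦ A ∧ᵖ B ⟧⁺ = ⟦ A ⟧⁺ ∧ ⟦ B ⟧⁺
  ⟦ A ∨ᵖ B ⟧⁺ = ⟦ A ⟧⁺ ∨ ⟦ B ⟧⁺
  ⟦ A ⁺ᵖ ⟧⁺ = ⟦ A ⟧⁺ ⁺

  prod⁺ : Fm⁺ → List Fm⁺ → Carrier
  prod⁺ A [] = ⟦ A ⟧⁺
  prod⁺ A (B ∷ Π) = ⟦ A ⟧⁺ · prod⁺ B Π

  TrueIn⁺ : Seq⁺ → Set ℓ₂
  TrueIn⁺ ((A ∷ Π) , C) = prod⁺ A Π ≤ ⟦ C ⟧⁺

StrongCompletenessACT⁺ω : Setω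
StrongCompletenessACT⁺ω =
  ∀ {h} (H : Seq⁺ → Set h) (Π : List⁺ Fm⁺) (C : Fm⁺) →
  (∀ {c ℓ₁ ℓ₂ ℓ} (M : CompleteωPAL c ℓ₁ ℓ₂ ℓ) (α : ℕ → CompleteωPAL.Carrier M) →
     (∀ s → H s → TrueIn⁺ M α s) → TrueIn⁺ M α (Π , C)) →
  H ⊢⁺ toList Π ⇒ C

record _×ω_ (A B : Setω) : Setω where
  constructor _,ω_
  field
    fst : A
    snd : B

{-# OPTIONS --safe #-}
module Submission where

-- A canonical phase model.  Given the hypotheses H, a set X of antecedents
-- determines the contexts Γ _ Δ ⇒ C that are derivable from H whatever Π ∈ X
-- is plugged in (Orth X, i.e. X⊥), and Cl X = X⊥⊥ is the set of antecedents
-- that can be plugged into all of them.  Sets of antecedents, ordered by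
-- X ⊆ Cl Y, with concatenation as product, form a residuated lattice in which
-- joins are unions; it is complete, and A* (A⁺) is just the union of the
-- powers of A.  Interpreting a variable x as {Π | H ⊢ Π ⇒ x}, every formula
-- satisfies [A] ∈ Cl ⟦A⟧ ⊆ {Π | H ⊢ Π ⇒ A}: the left rules (the ω-rule for
-- * and ⁺) give the first inclusion, the right rules the second.  Hence the
-- hypotheses are true in this model and every sequent true in it is derivable.

open import Defs
open import Level using (Level; Lift; lift; 0ℓ) renaming (suc to lsuc)
open import Function using (flip)
open import Data.Nat using (ℕ; zero; suc)
open import Data.Product using (Σ; _×_; _,_; proj₁; proj₂)
open import Data.Sum using (_⊎_; inj₁; inj₂)
open import Data.Unit using (⊤; tt)
open import Data.Empty using (⊥)
open import Data.List using (List; []; _∷_; _++_; [_]; replicate; concat)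
open import Data.List.Properties using (++-assoc; ++-identityʳ)
open import Data.List.NonEmpty using (_∷_)
open import Data.List.Relation.Unary.All using (All; []; _∷_; lookup)
open import Relation.Binary.PropositionalEquality using (_≡_; refl; sym; trans; cong; subst)
open import Relation.Binary.Lattice using (BoundedLattice)
open import Relation.Unary using (Pred)

-- W singles out the admissible antecedents (all lists for ACTω, the non-empty
-- ones for ACT⁺ω).  Elements are arbitrary predicates rather than closed sets,
-- ordered by X ⊆ Cl Y and identified up to mutual ≤, so no quotient is needed.
module SyntacticPhaseSpace
  {F : Set} {h : Level} (D : List F → F → Set h)
  (W : Pred (List F) 0ℓ) (W-++ : ∀ {a b} → W a → W b → W (a ++ b)) where

  Phase : Set (lsuc h)
  Phase = Pred (List F) h

  D-cast : ∀ {Π Π′ C} → Π ≡ Π′ → D Π C → D Π′ C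
  D-cast {C = C} = subst (flip D C)

  Orth : Phase → List F → List F → F → Set h
  Orth X Γ Δ C = ∀ Π → W Π → X Π → D (Γ ++ Π ++ Δ) C

  Cl : Phase → Phase
  Cl X Π = ∀ Γ Δ C → Orth X Γ Δ C → D (Γ ++ Π ++ Δ) C

  infix 4 _≤_ _≈_
  _≤_ : Phase → Phase → Set h
  X ≤ Y = ∀ Π → W Π → X Π → Cl Y Π

  _≈_ : Phase → Phase → Set h
  X ≈ Y = X ≤ Y × Y ≤ X

  Cl-incl : ∀ {X Π} → W Π → X Π → Cl X Π
  Cl-incl {Π = Π} w x Γ Δ C g = g Π w x

  Cl-mono : ∀ {X Y Π} → X ≤ Y → Cl X Π → Cl Y Π
  Cl-mono X≤Y c Γ Δ C g = c Γ Δ C (λ Π w x → X≤Y Π w x Γ Δ C g)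

  Cl-elim : ∀ {X C Π} → (∀ Π → W Π → X Π → D Π C) → Cl X Π → D Π C
  Cl-elim {C = C} {Π} X⊆D c =
    D-cast (++-identityʳ Π) (c [] [] C λ Π′ w x → D-cast (sym (++-identityʳ Π′)) (X⊆D Π′ w x))

  ≤-refl : ∀ {X} → X ≤ X
  ≤-refl Π = Cl-incl

  ≤-trans : ∀ {X Y Z} → X ≤ Y → Y ≤ Z → X ≤ Z
  ≤-trans X≤Y Y≤Z Π w x = Cl-mono Y≤Z (X≤Y Π w x)

  Cl-++ʳ : ∀ {X Z a b} → Cl X a → (∀ a′ → W a′ → X a′ → Cl Z (a′ ++ b)) → Cl Z (a ++ b)
  Cl-++ʳ {a = a} {b} ca k Γ Δ C g =
    D-cast (cong (Γ ++_) (sym (++-assoc a b Δ)))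
      (ca Γ (b ++ Δ) C λ a′ w x → D-cast (cong (Γ ++_) (++-assoc a′ b Δ)) (k a′ w x Γ Δ C g))

  Cl-++ˡ : ∀ {Y Z a b} → Cl Y b → (∀ b′ → W b′ → Y b′ → Cl Z (a ++ b′)) → Cl Z (a ++ b)
  Cl-++ˡ {a = a} {b} cb k Γ Δ C g =
    D-cast (sym (reassoc b)) (cb (Γ ++ a) Δ C λ b′ w y → D-cast (reassoc b′) (k b′ w y Γ Δ C g))
    where
    reassoc : ∀ b → Γ ++ (a ++ b) ++ Δ ≡ (Γ ++ a) ++ b ++ Δ
    reassoc b = trans (cong (Γ ++_) (++-assoc a b Δ)) (sym (++-assoc Γ a (b ++ Δ)))

  infixl 7 _·_
  _·_ : Phase → Phase → Phase
  (X · Y) Π = Σ (List F) λ a → Σ (List F) λ b → Π ≡ a ++ b × W a × W b × X a × Y b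

  Cl-· : ∀ {X Y a b} → Cl X a → Cl Y b → Cl (X · Y) (a ++ b)
  Cl-· ca cb = Cl-++ʳ ca λ a′ wa x → Cl-++ˡ cb λ b′ wb y →
    Cl-incl (W-++ wa wb) (a′ , b′ , refl , wa , wb , x , y)

  ·-assoc : ∀ X Y Z → (X · Y) · Z ≈ X · (Y · Z)
  ·-assoc X Y Z =
      (λ { _ w (_ , c , refl , _ , wc , (a , b , refl , wa , wb , x , y) , z) →
             Cl-incl w (a , b ++ c , ++-assoc a b c , wa , W-++ wb wc , x
                       , (b , c , refl , wb , wc , y , z)) })
    , (λ { _ w (a , _ , refl , wa , _ , x , (b , c , refl , wb , wc , y , z)) →
             Cl-incl w (a ++ b , c , sym (++-assoc a b c) , W-++ wa wb , wc
                       , (a , b , refl , wa , wb , x , y) , z) })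

  _∖_ _⁄_ _∨_ _∧_ : Phase → Phase → Phase
  (X ∖ Z) Π = ∀ Π′ → W Π′ → Cl X Π′ → Cl Z (Π′ ++ Π)
  (Z ⁄ Y) Π = ∀ Π′ → W Π′ → Cl Y Π′ → Cl Z (Π ++ Π′)
  (X ∨ Y) Π = X Π ⊎ Y Π
  (X ∧ Y) Π = Cl X Π × Cl Y Π

  resid-∖ : ∀ X Y Z → (Y ≤ X ∖ Z → X · Y ≤ Z) × (X · Y ≤ Z → Y ≤ X ∖ Z)
  resid-∖ X Y Z =
      (λ { Y≤X∖Z _ _ (a , b , refl , wa , wb , x , y) →
             Cl-++ˡ (Y≤X∖Z b wb y) λ b′ _ f → f a wa (Cl-incl wa x) })
    , λ XY≤Z Π w y → Cl-incl w λ Π′ _ x → Cl-mono XY≤Z (Cl-· x (Cl-incl w y))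

  resid-⁄ : ∀ X Y Z → (X ≤ Z ⁄ Y → X · Y ≤ Z) × (X · Y ≤ Z → X ≤ Z ⁄ Y)
  resid-⁄ X Y Z =
      (λ { X≤Z⁄Y _ _ (a , b , refl , wa , wb , x , y) →
             Cl-++ʳ (X≤Z⁄Y a wa x) λ a′ _ f → f b wb (Cl-incl wb y) })
    , λ XY≤Z Π w x → Cl-incl w λ Π′ _ y → Cl-mono XY≤Z (Cl-· (Cl-incl w x) y)

  ⊤ᴾ ⊥ᴾ 𝟙ᴾ : Phase
  ⊤ᴾ _ = Lift h ⊤
  ⊥ᴾ _ = Lift h ⊥
  𝟙ᴾ Π = Lift h (Π ≡ [])

  ⋃ ⋂ : {I : Set} → (I → Phase) → Phase
  ⋃ f Π = Σ _ λ k → f k Π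
  ⋂ f Π = ∀ k → Cl (f k) Π

  boundedLattice : BoundedLattice (lsuc h) h h
  boundedLattice = record
    { Carrier = Phase ; _≈_ = _≈_ ; _≤_ = _≤_ ; _∨_ = _∨_ ; _∧_ = _∧_ ; ⊤ = ⊤ᴾ ; ⊥ = ⊥ᴾ
    ; isBoundedLattice = record
      { isLattice = record
        { isPartialOrder = record
          { isPreorder = record
            { isEquivalence = record
              { refl = ≤-refl , ≤-refl
              ; sym = λ (p , q) → q , p
              ; trans = λ (p , q) (p′ , q′) → ≤-trans p p′ , ≤-trans q′ q }
            ; reflexive = proj₁
            ; trans = ≤-trans }
          ; antisym = _,_ }
        ; supremum = λ X Y → (λ Π w x → Cl-incl w (inj₁ x)) , (λ Π w y → Cl-incl w (inj₂ y))
                           , λ Z X≤Z Y≤Z Π w → λ { (inj₁ x) → X≤Z Π w x ; (inj₂ y) → Y≤Z Π w y }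
        ; infimum = λ X Y → (λ Π w → proj₁) , (λ Π w → proj₂)
                          , λ Z Z≤X Z≤Y Π w z → Cl-incl w (Z≤X Π w z , Z≤Y Π w z) }
      ; maximum = λ X Π w _ → Cl-incl w (lift tt)
      ; minimum = λ X Π w () } }

  ⋃-isLUB : {I : Set} (f : I → Phase) → IsLUB boundedLattice f (⋃ f)
  ⋃-isLUB f = (λ k Π w x → Cl-incl w (k , x)) , λ Z f≤Z Π w (k , x) → f≤Z k Π w x

  ⋂-isGLB : {I : Set} (f : I → Phase) → IsGLB boundedLattice f (⋂ f)
  ⋂-isGLB f = (λ k Π w c → c k) , λ Z Z≤f Π w z → Cl-incl w λ k → Z≤f k Π w z

  isComplete : IsComplete boundedLattice 0ℓ
  isComplete I f = (⋃ f , ⋃-isLUB f) , (⋂ f , ⋂-isGLB f)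

  srbl : SRBL (lsuc h) h h
  srbl = record
    { boundedLattice = boundedLattice ; _·_ = _·_ ; _∖_ = _∖_ ; _⁄_ = _⁄_
    ; ·-assoc = ·-assoc ; resid-∖ = resid-∖ ; resid-⁄ = resid-⁄ }

  completeωPAL : CompleteωPAL (lsuc h) h h 0ℓ
  completeωPAL = record
    { ωpal = record
      { srbl = srbl ; _⁺ = λ X → ⋃ (pow⁺ srbl X) ; ⁺-sup = λ X → ⋃-isLUB (pow⁺ srbl X) }
    ; complete = isComplete }

  rbl : W [] → RBL (lsuc h) h h
  rbl w[] = record
    { srbl = srbl ; 𝟙 = 𝟙ᴾ
    ; 𝟙-unitˡ = λ X → (λ { _ _ (_ , b , refl , _ , wb , lift refl , x) → Cl-incl wb x })
                    , λ Π w x → Cl-incl w ([] , Π , refl , w[] , w , lift refl , x)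
    ; 𝟙-unitʳ = λ X → (λ { _ _ (a , _ , refl , wa , _ , x , lift refl) →
                              subst (Cl X) (sym (++-identityʳ a)) (Cl-incl wa x) })
                    , λ Π w x → Cl-incl w (Π , [] , sym (++-identityʳ Π) , w , w[] , x , lift refl) }

  completeωAL : W [] → CompleteωAL (lsuc h) h h 0ℓ
  completeωAL w[] = record
    { ωal = record
      { rbl = rbl w[] ; _⋆ = λ X → ⋃ (pow (rbl w[]) X) ; ⋆-sup = λ X → ⋃-isLUB (pow (rbl w[]) X) }
    ; complete = isComplete }

module ACTωCanonical {h} (H : Seq → Set h) where
  open SyntacticPhaseSpace (H ⊢_⇒_) (λ _ → ⊤) (λ _ _ → tt) public

  M : CompleteωAL (lsuc h) h h 0ℓ
  M = completeωAL tt

  α : ℕ → Phase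
  α x Π = H ⊢ Π ⇒ var x

  ⟦_⟧ᶜ : Fm → Phase
  ⟦ A ⟧ᶜ = ⟦_⟧ M α A

  mutual
    ⟦⟧⊆⊢ : ∀ A {Π} → ⟦ A ⟧ᶜ Π → H ⊢ Π ⇒ A
    ⟦⟧⊆⊢ (var x) d = d
    ⟦⟧⊆⊢ ⊤ᶠ _ = ⊤R
    ⟦⟧⊆⊢ ⊥ᶠ (lift ())
    ⟦⟧⊆⊢ 𝟏ᶠ (lift refl) = 𝟏R
    ⟦⟧⊆⊢ (A ∖ᶠ B) f = ∖R (Cl⟦⟧⊆⊢ B (f [ A ] tt ([A]∈⟦A⟧ A)))
    ⟦⟧⊆⊢ (B ⁄ᶠ A) f = ⁄R (Cl⟦⟧⊆⊢ B (f [ A ] tt ([A]∈⟦A⟧ A)))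
    ⟦⟧⊆⊢ (A ·ᶠ B) (_ , _ , refl , _ , _ , x , y) = ·R (⟦⟧⊆⊢ A x) (⟦⟧⊆⊢ B y)
    ⟦⟧⊆⊢ (A ∧ᶠ B) (x , y) = ∧R (Cl⟦⟧⊆⊢ A x) (Cl⟦⟧⊆⊢ B y)
    ⟦⟧⊆⊢ (A ∨ᶠ B) (inj₁ x) = ∨R₁ (⟦⟧⊆⊢ A x)
    ⟦⟧⊆⊢ (A ∨ᶠ B) (inj₂ y) = ∨R₂ (⟦⟧⊆⊢ B y)
    ⟦⟧⊆⊢ (A ⋆ᶠ) (n , x) with pow⟦⟧-split A n x
    ... | Πs , refl , ds = ⋆R Πs (lookup ds)

    pow⟦⟧-split : ∀ A n {Π} → pow (rbl tt) ⟦ A ⟧ᶜ n Π →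
                  Σ (List (List Fm)) λ Πs → concat Πs ≡ Π × All (H ⊢_⇒ A) Πs
    pow⟦⟧-split A zero (lift refl) = [] , refl , []
    pow⟦⟧-split A (suc n) (a , _ , refl , _ , _ , x , y) with pow⟦⟧-split A n y
    ... | Πs , refl , ds = a ∷ Πs , refl , ⟦⟧⊆⊢ A x ∷ ds

    Cl⟦⟧⊆⊢ : ∀ A {Π} → Cl ⟦ A ⟧ᶜ Π → H ⊢ Π ⇒ A
    Cl⟦⟧⊆⊢ A = Cl-elim λ _ _ → ⟦⟧⊆⊢ A

    ⊢⊆Cl⟦⟧ : ∀ A {Π} → H ⊢ Π ⇒ A → Cl ⟦ A ⟧ᶜ Π
    ⊢⊆Cl⟦⟧ A d Γ Δ C g = cut d ([A]∈⟦A⟧ A Γ Δ C g)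

    [A]∈⟦A⟧ : ∀ A → Cl ⟦ A ⟧ᶜ [ A ]
    [A]∈⟦A⟧ (var x) = Cl-incl tt ax
    [A]∈⟦A⟧ ⊤ᶠ = Cl-incl tt (lift tt)
    [A]∈⟦A⟧ ⊥ᶠ Γ Δ C g = ⊥L
    [A]∈⟦A⟧ 𝟏ᶠ Γ Δ C g = 𝟏L (g [] tt (lift refl))
    [A]∈⟦A⟧ (A ∖ᶠ B) = Cl-incl tt λ Π _ c →
      ⊢⊆Cl⟦⟧ B (∖L {Γ = []} {Δ = []} (Cl⟦⟧⊆⊢ A c) ax)
    [A]∈⟦A⟧ (B ⁄ᶠ A) = Cl-incl tt λ Π _ c →
      ⊢⊆Cl⟦⟧ B (D-cast (cong (B ⁄ᶠ A ∷_) (++-identityʳ Π)) (⁄L {Γ = []} {Δ = []} (Cl⟦⟧⊆⊢ A c) ax))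
    [A]∈⟦A⟧ (A ·ᶠ B) Γ Δ C g = ·L (Cl-· ([A]∈⟦A⟧ A) ([A]∈⟦A⟧ B) Γ Δ C g)
    [A]∈⟦A⟧ (A ∧ᶠ B) = Cl-incl tt
      (⊢⊆Cl⟦⟧ A (∧L₁ {Γ = []} {Δ = []} ax) , ⊢⊆Cl⟦⟧ B (∧L₂ {Γ = []} {Δ = []} ax))
    [A]∈⟦A⟧ (A ∨ᶠ B) Γ Δ C g =
      ∨L ([A]∈⟦A⟧ A Γ Δ C λ Π w x → g Π w (inj₁ x)) ([A]∈⟦A⟧ B Γ Δ C λ Π w y → g Π w (inj₂ y))
    [A]∈⟦A⟧ (A ⋆ᶠ) Γ Δ C g = ⋆L λ n → replicate∈pow⟦⟧ A n Γ Δ C λ Π w x → g Π w (n , x)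

    replicate∈pow⟦⟧ : ∀ A n → Cl (pow (rbl tt) ⟦ A ⟧ᶜ n) (replicate n A)
    replicate∈pow⟦⟧ A zero = Cl-incl tt (lift refl)
    replicate∈pow⟦⟧ A (suc n) = Cl-· ([A]∈⟦A⟧ A) (replicate∈pow⟦⟧ A n)

  Π∈⟦Π⟧* : ∀ Π → Cl (⟦_⟧* M α Π) Π
  Π∈⟦Π⟧* [] = Cl-incl tt (lift refl)
  Π∈⟦Π⟧* (A ∷ []) = [A]∈⟦A⟧ A
  Π∈⟦Π⟧* (A ∷ B ∷ Π) = Cl-· ([A]∈⟦A⟧ A) (Π∈⟦Π⟧* (B ∷ Π))

  ⟦⟧*-cut : ∀ Π {S Γ Δ C} → ⟦_⟧* M α Π S → H ⊢ Γ ++ Π ++ Δ ⇒ C → H ⊢ Γ ++ S ++ Δ ⇒ C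
  ⟦⟧*-cut [] (lift refl) d = d
  ⟦⟧*-cut (A ∷ []) x d = cut (⟦⟧⊆⊢ A x) d
  ⟦⟧*-cut (A ∷ B ∷ Π) {Γ = Γ} {Δ} (a , b , refl , _ , _ , x , y) d =
    D-cast (trans (++-assoc Γ a (b ++ Δ)) (cong (Γ ++_) (sym (++-assoc a b Δ))))
      (⟦⟧*-cut (B ∷ Π) {Γ = Γ ++ a} y (D-cast (sym (++-assoc Γ a _)) (cut (⟦⟧⊆⊢ A x) d)))

  hypotheses-true : ∀ s → H s → TrueIn M α s
  hypotheses-true (Π , C) hs S _ x = ⊢⊆Cl⟦⟧ C (D-cast (++-identityʳ S)
    (⟦⟧*-cut Π {Γ = []} {Δ = []} x (D-cast (sym (++-identityʳ Π)) (hyp hs))))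

ACTω-stronglyComplete : StrongCompletenessACTω
ACTω-stronglyComplete H Π C valid = Cl⟦⟧⊆⊢ C (Cl-mono (valid M α hypotheses-true) (Π∈⟦Π⟧* Π))
  where open ACTωCanonical H

NonEmpty-++ : ∀ {A : Set} {a b : List A} → NonEmpty a → NonEmpty b → NonEmpty (a ++ b)
NonEmpty-++ nonEmpty _ = nonEmpty

module ACT⁺ωCanonical {h} (H : Seq⁺ → Set h) where
  open SyntacticPhaseSpace (H ⊢⁺_⇒_) NonEmpty NonEmpty-++ public

  M : CompleteωPAL (lsuc h) h h 0ℓ
  M = completeωPAL

  α : ℕ → Phase
  α x Π = H ⊢⁺ Π ⇒ var x

  ⟦_⟧ᶜ : Fm⁺ → Phase
  ⟦ A ⟧ᶜ = ⟦_⟧⁺ M α A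

  mutual
    ⟦⟧⊆⊢ : ∀ A {Π} → NonEmpty Π → ⟦ A ⟧ᶜ Π → H ⊢⁺ Π ⇒ A
    ⟦⟧⊆⊢ (var x) _ d = d
    ⟦⟧⊆⊢ ⊤ᵖ w _ = ⊤R w
    ⟦⟧⊆⊢ ⊥ᵖ _ (lift ())
    ⟦⟧⊆⊢ (A ∖ᵖ B) w f = ∖R w (Cl⟦⟧⊆⊢ B (f [ A ] nonEmpty ([A]∈⟦A⟧ A)))
    ⟦⟧⊆⊢ (B ⁄ᵖ A) w f = ⁄R w (Cl⟦⟧⊆⊢ B (f [ A ] nonEmpty ([A]∈⟦A⟧ A)))
    ⟦⟧⊆⊢ (A ·ᵖ B) _ (_ , _ , refl , wa , wb , x , y) = ·R (⟦⟧⊆⊢ A wa x) (⟦⟧⊆⊢ B wb y)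
    ⟦⟧⊆⊢ (A ∧ᵖ B) _ (x , y) = ∧R (Cl⟦⟧⊆⊢ A x) (Cl⟦⟧⊆⊢ B y)
    ⟦⟧⊆⊢ (A ∨ᵖ B) w (inj₁ x) = ∨R₁ (⟦⟧⊆⊢ A w x)
    ⟦⟧⊆⊢ (A ∨ᵖ B) w (inj₂ y) = ∨R₂ (⟦⟧⊆⊢ B w y)
    ⟦⟧⊆⊢ (A ⁺ᵖ) w (n , x) with pow⁺⟦⟧-split A n w x
    ... | Π₁ , Πs , refl , ds = ⁺R Π₁ Πs (lookup ds)

    pow⁺⟦⟧-split : ∀ A n {Π} → NonEmpty Π → pow⁺ srbl ⟦ A ⟧ᶜ n Π →
                   Σ (List Fm⁺) λ Π₁ → Σ (List (List Fm⁺)) λ Πs →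
                   concat (Π₁ ∷ Πs) ≡ Π × All (H ⊢⁺_⇒ A) (Π₁ ∷ Πs)
    pow⁺⟦⟧-split A zero {Π} w x = Π , [] , ++-identityʳ Π , ⟦⟧⊆⊢ A w x ∷ []
    pow⁺⟦⟧-split A (suc n) _ (a , _ , refl , wa , wb , x , y) with pow⁺⟦⟧-split A n wb y
    ... | Π₁ , Πs , refl , ds = a , Π₁ ∷ Πs , refl , ⟦⟧⊆⊢ A wa x ∷ ds

    Cl⟦⟧⊆⊢ : ∀ A {Π} → Cl ⟦ A ⟧ᶜ Π → H ⊢⁺ Π ⇒ A
    Cl⟦⟧⊆⊢ A = Cl-elim λ _ → ⟦⟧⊆⊢ A

    ⊢⊆Cl⟦⟧ : ∀ A {Π} → H ⊢⁺ Π ⇒ A → Cl ⟦ A ⟧ᶜ Π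
    ⊢⊆Cl⟦⟧ A d Γ Δ C g = cut d ([A]∈⟦A⟧ A Γ Δ C g)

    [A]∈⟦A⟧ : ∀ A → Cl ⟦ A ⟧ᶜ [ A ]
    [A]∈⟦A⟧ (var x) = Cl-incl nonEmpty ax
    [A]∈⟦A⟧ ⊤ᵖ = Cl-incl nonEmpty (lift tt)
    [A]∈⟦A⟧ ⊥ᵖ Γ Δ C g = ⊥L
    [A]∈⟦A⟧ (A ∖ᵖ B) = Cl-incl nonEmpty λ Π _ c →
      ⊢⊆Cl⟦⟧ B (∖L {Γ = []} {Δ = []} (Cl⟦⟧⊆⊢ A c) ax)
    [A]∈⟦A⟧ (B ⁄ᵖ A) = Cl-incl nonEmpty λ Π _ c →
      ⊢⊆Cl⟦⟧ B (D-cast (cong (B ⁄ᵖ A ∷_) (++-identityʳ Π)) (⁄L {Γ = []} {Δ = []} (Cl⟦⟧⊆⊢ A c) ax))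
    [A]∈⟦A⟧ (A ·ᵖ B) Γ Δ C g = ·L (Cl-· ([A]∈⟦A⟧ A) ([A]∈⟦A⟧ B) Γ Δ C g)
    [A]∈⟦A⟧ (A ∧ᵖ B) = Cl-incl nonEmpty
      (⊢⊆Cl⟦⟧ A (∧L₁ {Γ = []} {Δ = []} ax) , ⊢⊆Cl⟦⟧ B (∧L₂ {Γ = []} {Δ = []} ax))
    [A]∈⟦A⟧ (A ∨ᵖ B) Γ Δ C g =
      ∨L ([A]∈⟦A⟧ A Γ Δ C λ Π w x → g Π w (inj₁ x)) ([A]∈⟦A⟧ B Γ Δ C λ Π w y → g Π w (inj₂ y))
    [A]∈⟦A⟧ (A ⁺ᵖ) Γ Δ C g = ⁺L λ n → replicate∈pow⁺⟦⟧ A n Γ Δ C λ Π w x → g Π w (n , x)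

    replicate∈pow⁺⟦⟧ : ∀ A n → Cl (pow⁺ srbl ⟦ A ⟧ᶜ n) (replicate (suc n) A)
    replicate∈pow⁺⟦⟧ A zero = [A]∈⟦A⟧ A
    replicate∈pow⁺⟦⟧ A (suc n) = Cl-· ([A]∈⟦A⟧ A) (replicate∈pow⁺⟦⟧ A n)

  A∷Π∈prod⁺ : ∀ A Π → Cl (prod⁺ M α A Π) (A ∷ Π)
  A∷Π∈prod⁺ A [] = [A]∈⟦A⟧ A
  A∷Π∈prod⁺ A (B ∷ Π) = Cl-· ([A]∈⟦A⟧ A) (A∷Π∈prod⁺ B Π)

  prod⁺-cut : ∀ A Π {S Γ Δ C} → NonEmpty S → prod⁺ M α A Π S →
              H ⊢⁺ Γ ++ (A ∷ Π) ++ Δ ⇒ C → H ⊢⁺ Γ ++ S ++ Δ ⇒ C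
  prod⁺-cut A [] w x d = cut (⟦⟧⊆⊢ A w x) d
  prod⁺-cut A (B ∷ Π) {Γ = Γ} {Δ} _ (a , b , refl , wa , wb , x , y) d =
    D-cast (trans (++-assoc Γ a (b ++ Δ)) (cong (Γ ++_) (sym (++-assoc a b Δ))))
      (prod⁺-cut B Π {Γ = Γ ++ a} wb y (D-cast (sym (++-assoc Γ a _)) (cut (⟦⟧⊆⊢ A wa x) d)))

  hypotheses-true : ∀ s → H s → TrueIn⁺ M α s
  hypotheses-true ((A ∷ Π) , C) hs S w x = ⊢⊆Cl⟦⟧ C (D-cast (++-identityʳ S)
    (prod⁺-cut A Π {Γ = []} {Δ = []} w x (D-cast (sym (++-identityʳ (A ∷ Π))) (hyp hs))))

ACT⁺ω-stronglyComplete : StrongCompletenessACT⁺ω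
ACT⁺ω-stronglyComplete H (A ∷ Π) C valid =
  Cl⟦⟧⊆⊢ C (Cl-mono (valid M α hypotheses-true) (A∷Π∈prod⁺ A Π))
  where open ACT⁺ωCanonical H

corollary1 : StrongCompletenessACTω ×ω StrongCompletenessACT⁺ω
corollary1 = ACTω-stronglyComplete ,ω ACT⁺ω-stronglyComplete
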